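{- Every MV-algebra $M$ has a universal state. That is, there exist an MV-algebra $\Upsilon M$ and a state $\upsilon_M\colon M\to\Upsilon M$ such that for every MV-algebra $N$ and every state $t\colon M\to N$ there is exactly one MV-algebra homomorphism $h\colon\Upsilon M\to N$ with $h\circ\upsilon_M=t$.
   Context: In an MV-algebra, $a\odot b=\neg(\neg a\oplus\neg b)$ and $1=\neg 0$. For an MV-algebra $N$, $\Xi N$ is the unital Abelian $\ell$-group associated with $N$ by Mundici's equivalence, with $N$ identified with the unit interval $\{x\in\Xi N\mid 0\le x\le1\}$. A state of MV-algebras $s\colon M\to N$ is a function with $s(1)=1$ and $s(a\oplus b)=s(a)+s(b)$ (sum in $\Xi N$) whenever $a\odot b=0$. -}

module Defs where

open import Level using (Level; _⊔_; suc; Setω)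
open import Data.Product using (_×_; Σ; _,_)
open import Relation.Binary.Structures using (IsEquivalence)

record MVAlgebra (c ℓ : Level) : Set (suc (c ⊔ ℓ)) where
  infix  4 _≈_
  infixl 6 _⊕_
  field
    Carrier       : Set c
    _≈_           : Carrier → Carrier → Set ℓ
    _⊕_           : Carrier → Carrier → Carrier
    ¬_            : Carrier → Carrier
    𝟘             : Carrier
    isEquivalence : IsEquivalence _≈_
    ⊕-cong        : ∀ {x x′ y y′} → x ≈ x′ → y ≈ y′ → (x ⊕ y) ≈ (x′ ⊕ y′)
    ¬-cong        : ∀ {x x′} → x ≈ x′ → (¬ x) ≈ (¬ x′)
    ⊕-assoc       : ∀ x y z → ((x ⊕ y) ⊕ z) ≈ (x ⊕ (y ⊕ z))
    ⊕-comm        : ∀ x y → (x ⊕ y) ≈ (y ⊕ x)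
    ⊕-identityʳ   : ∀ x → (x ⊕ 𝟘) ≈ x
    ¬-involutive  : ∀ x → (¬ (¬ x)) ≈ x
    ⊕-absorb      : ∀ x → (x ⊕ (¬ 𝟘)) ≈ (¬ 𝟘)
    łukasiewicz   : ∀ x y → ((¬ ((¬ x) ⊕ y)) ⊕ y) ≈ ((¬ ((¬ y) ⊕ x)) ⊕ x)

  𝟙 : Carrier
  𝟙 = ¬ 𝟘

  _⊙_ : Carrier → Carrier → Carrier
  x ⊙ y = ¬ ((¬ x) ⊕ (¬ y))

  -- "x + y = z in ΞN" for x, y, z in the unit interval N ⊆ ΞN.
  -- In ΞN one has x ⊙ y = (x + y - 1) ∨ 0 and x ⊕ y = (x + y) ∧ 1, hence
  -- x + y = z with z ∈ [0,1] holds exactly when x ⊙ y = 0 and x ⊕ y = z.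
  SumIs : Carrier → Carrier → Carrier → Set ℓ
  SumIs x y z = ((x ⊙ y) ≈ 𝟘) × ((x ⊕ y) ≈ z)

open MVAlgebra

record IsMVHom {c₁ ℓ₁ c₂ ℓ₂} (M : MVAlgebra c₁ ℓ₁) (N : MVAlgebra c₂ ℓ₂)
               (h : Carrier M → Carrier N) : Set (c₁ ⊔ ℓ₁ ⊔ ℓ₂) where
  field
    cong  : ∀ {x y} → _≈_ M x y → _≈_ N (h x) (h y)
    hom-⊕ : ∀ x y → _≈_ N (h (_⊕_ M x y)) (_⊕_ N (h x) (h y))
    hom-¬ : ∀ x → _≈_ N (h (¬_ M x)) (¬_ N (h x))
    hom-𝟘 : _≈_ N (h (𝟘 M)) (𝟘 N)

record IsState {c₁ ℓ₁ c₂ ℓ₂} (M : MVAlgebra c₁ ℓ₁) (N : MVAlgebra c₂ ℓ₂)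
               (s : Carrier M → Carrier N) : Set (c₁ ⊔ ℓ₁ ⊔ ℓ₂) where
  field
    cong     : ∀ {x y} → _≈_ M x y → _≈_ N (s x) (s y)
    unital   : _≈_ N (s (𝟙 M)) (𝟙 N)
    additive : ∀ a b → _≈_ M (_⊙_ M a b) (𝟘 M) →
               SumIs N (s a) (s b) (s (_⊕_ M a b))

record UniversalState {c ℓ} (M : MVAlgebra c ℓ) : Setω where
  field
    uc uℓ     : Level
    Υ         : MVAlgebra uc uℓ
    υ         : Carrier M → Carrier Υ
    υ-state   : IsState M Υ υ
    factor    : ∀ {c′ ℓ′} (N : MVAlgebra c′ ℓ′) (t : Carrier M → Carrier N) →
                IsState M N t →
                Σ (Carrier Υ → Carrier N) λ h →
                  IsMVHom Υ N h × (∀ x → _≈_ N (h (υ x)) (t x))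
    unique    : ∀ {c′ ℓ′} (N : MVAlgebra c′ ℓ′) (t : Carrier M → Carrier N) →
                IsState M N t →
                (h₁ h₂ : Carrier Υ → Carrier N) →
                IsMVHom Υ N h₁ → (∀ x → _≈_ N (h₁ (υ x)) (t x)) →
                IsMVHom Υ N h₂ → (∀ x → _≈_ N (h₂ (υ x)) (t x)) →
                ∀ y → _≈_ N (h₁ y) (h₂ y)

{-# OPTIONS --safe #-}
-- Once "s a + s b = s (a ⊕ b) in ΞN" is read as  s a ⊙ s b = 0  and  s a ⊕ s b = s (a ⊕ b),
-- being a state is a set of equations on the values of s.  Hence the universal state is the
-- generator map into the MV-algebra presented by one generator [a] per a ∈ M subject to
-- [a] = [b] for a ≈ b,  [1] = 1,  and  [a] ⊙ [b] = 0,  [a] ⊕ [b] = [a ⊕ b]  whenever a ⊙ b = 0.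
module Submission where

open import Defs
open import Level using (_⊔_)
open import Data.Product using (_,_; proj₁; proj₂)
open import Relation.Binary.Structures using (IsEquivalence)

infixl 6 _⊕_

data Term {a} (X : Set a) : Set a where
  var : X → Term X
  _⊕_ : Term X → Term X → Term X
  ¬_  : Term X → Term X
  𝟘   : Term X

module _ {a} {X : Set a} where

  infixl 6 _⊙_

  _⊙_ : Term X → Term X → Term X
  x ⊙ y = ¬ ((¬ x) ⊕ (¬ y))

  𝟙 : Term X
  𝟙 = ¬ 𝟘

module _ {c ℓ a} (N : MVAlgebra c ℓ) {X : Set a} where
  private module N = MVAlgebra N

  eval : (X → N.Carrier) → Term X → N.Carrier
  eval ρ (var x) = ρ x
  eval ρ (x ⊕ y) = eval ρ x N.⊕ eval ρ y
  eval ρ (¬ x)   = N.¬ eval ρ x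
  eval ρ 𝟘       = N.𝟘

module Presentation {a r} (X : Set a) (R : Term X → Term X → Set r) where

  infix 4 _∼_

  data _∼_ : Term X → Term X → Set (a ⊔ r) where
    ∼-refl       : ∀ {x} → x ∼ x
    ∼-sym        : ∀ {x y} → x ∼ y → y ∼ x
    ∼-trans      : ∀ {x y z} → x ∼ y → y ∼ z → x ∼ z
    ⊕-cong       : ∀ {x x′ y y′} → x ∼ x′ → y ∼ y′ → x ⊕ y ∼ x′ ⊕ y′
    ¬-cong       : ∀ {x x′} → x ∼ x′ → ¬ x ∼ ¬ x′
    ⊕-assoc      : ∀ x y z → (x ⊕ y) ⊕ z ∼ x ⊕ (y ⊕ z)
    ⊕-comm       : ∀ x y → x ⊕ y ∼ y ⊕ x
    ⊕-identityʳ  : ∀ x → x ⊕ 𝟘 ∼ x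
    ¬-involutive : ∀ x → ¬ (¬ x) ∼ x
    ⊕-absorb     : ∀ x → x ⊕ 𝟙 ∼ 𝟙
    łukasiewicz  : ∀ x y → ¬ ((¬ x) ⊕ y) ⊕ y ∼ ¬ ((¬ y) ⊕ x) ⊕ x
    relation     : ∀ {x y} → R x y → x ∼ y

  presented : MVAlgebra a (a ⊔ r)
  presented = record
    { Carrier       = Term X
    ; _≈_           = _∼_
    ; _⊕_           = _⊕_
    ; ¬_            = ¬_
    ; 𝟘             = 𝟘
    ; isEquivalence = record { refl = ∼-refl ; sym = ∼-sym ; trans = ∼-trans }
    ; ⊕-cong        = ⊕-cong
    ; ¬-cong        = ¬-cong
    ; ⊕-assoc       = ⊕-assoc
    ; ⊕-comm        = ⊕-comm
    ; ⊕-identityʳ   = ⊕-identityʳ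
    ; ¬-involutive  = ¬-involutive
    ; ⊕-absorb      = ⊕-absorb
    ; łukasiewicz   = łukasiewicz
    }

  module _ {c ℓ} (N : MVAlgebra c ℓ) where
    private
      module N = MVAlgebra N
      module ≈ = IsEquivalence N.isEquivalence

    Satisfies : (X → N.Carrier) → Set (a ⊔ r ⊔ ℓ)
    Satisfies ρ = ∀ {x y} → R x y → eval N ρ x N.≈ eval N ρ y

    eval-cong : ∀ {ρ} → Satisfies ρ → ∀ {x y} → x ∼ y → eval N ρ x N.≈ eval N ρ y
    eval-cong sat ∼-refl               = ≈.refl
    eval-cong sat (∼-sym p)            = ≈.sym (eval-cong sat p)
    eval-cong sat (∼-trans p q)        = ≈.trans (eval-cong sat p) (eval-cong sat q)
    eval-cong sat (⊕-cong p q)         = N.⊕-cong (eval-cong sat p) (eval-cong sat q)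
    eval-cong sat (¬-cong p)           = N.¬-cong (eval-cong sat p)
    eval-cong sat (⊕-assoc x y z)      = N.⊕-assoc _ _ _
    eval-cong sat (⊕-comm x y)         = N.⊕-comm _ _
    eval-cong sat (⊕-identityʳ x)      = N.⊕-identityʳ _
    eval-cong sat (¬-involutive x)     = N.¬-involutive _
    eval-cong sat (⊕-absorb x)         = N.⊕-absorb _
    eval-cong sat (łukasiewicz x y)    = N.łukasiewicz _ _
    eval-cong sat (relation rel)       = sat rel

    eval-isMVHom : ∀ {ρ} → Satisfies ρ → IsMVHom presented N (eval N ρ)
    eval-isMVHom sat = record
      { cong  = eval-cong sat
      ; hom-⊕ = λ _ _ → ≈.refl
      ; hom-¬ = λ _ → ≈.refl
      ; hom-𝟘 = ≈.refl
      }

    hom-extension-unique :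
      ∀ {ρ : X → N.Carrier} {h₁ h₂} →
      IsMVHom presented N h₁ → (∀ x → h₁ (var x) N.≈ ρ x) →
      IsMVHom presented N h₂ → (∀ x → h₂ (var x) N.≈ ρ x) →
      ∀ y → h₁ y N.≈ h₂ y
    hom-extension-unique {h₁ = h₁} {h₂ = h₂} H₁ h₁-extends H₂ h₂-extends = go
      where
        module H₁ = IsMVHom H₁
        module H₂ = IsMVHom H₂
        go : ∀ y → h₁ y N.≈ h₂ y
        go (var x) = ≈.trans (h₁-extends x) (≈.sym (h₂-extends x))
        go (x ⊕ y) = ≈.trans (H₁.hom-⊕ x y) (≈.trans (N.⊕-cong (go x) (go y)) (≈.sym (H₂.hom-⊕ x y)))
        go (¬ x)   = ≈.trans (H₁.hom-¬ x) (≈.trans (N.¬-cong (go x)) (≈.sym (H₂.hom-¬ x)))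
        go 𝟘       = ≈.trans H₁.hom-𝟘 (≈.sym H₂.hom-𝟘)

module StatePresentation {c ℓ} (M : MVAlgebra c ℓ) where
  private module M = MVAlgebra M

  data StateRelation : Term M.Carrier → Term M.Carrier → Set (c ⊔ ℓ) where
    respects-≈ : ∀ {a b} → a M.≈ b → StateRelation (var a) (var b)
    unital     : StateRelation (var M.𝟙) 𝟙
    disjoint   : ∀ a b → a M.⊙ b M.≈ M.𝟘 → StateRelation (var a ⊙ var b) 𝟘
    additive   : ∀ a b → a M.⊙ b M.≈ M.𝟘 → StateRelation (var a ⊕ var b) (var (a M.⊕ b))

  open Presentation M.Carrier StateRelation public

  var-isState : IsState M presented var
  var-isState = record
    { cong     = λ a≈b → relation (respects-≈ a≈b)
    ; unital   = relation unital
    ; additive = λ a b a⊙b≈0 → relation (disjoint a b a⊙b≈0) , relation (additive a b a⊙b≈0)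
    }

  state-satisfies : ∀ {c′ ℓ′} (N : MVAlgebra c′ ℓ′) {t} → IsState M N t → Satisfies N t
  state-satisfies N ts (respects-≈ a≈b)      = IsState.cong ts a≈b
  state-satisfies N ts unital                = IsState.unital ts
  state-satisfies N ts (disjoint a b a⊙b≈0)  = proj₁ (IsState.additive ts a b a⊙b≈0)
  state-satisfies N ts (additive a b a⊙b≈0)  = proj₂ (IsState.additive ts a b a⊙b≈0)

corollary4p3 : ∀ {c ℓ} (M : MVAlgebra c ℓ) → UniversalState M
corollary4p3 {c} {ℓ} M = record
  { uc      = c
  ; uℓ      = c ⊔ ℓ
  ; Υ       = presented
  ; υ       = var
  ; υ-state = var-isState
  ; factor  = λ N t ts →
      eval N t , eval-isMVHom N (state-satisfies N ts)
               , λ _ → IsEquivalence.refl (MVAlgebra.isEquivalence N)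
  ; unique  = λ N t _ _ _ → hom-extension-unique N {t}
  }
  where open StatePresentation M
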